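{- Reduction $\to$ in $\lambda^{\mathsf F}_{\mathfrak m}$ is confluent: if $M\twoheadrightarrow N_1$ and $M\twoheadrightarrow N_2$ then there exists $P$ with $N_1\twoheadrightarrow P$ and $N_2\twoheadrightarrow P$.
   Context: Types: $A,B ::= a \mid \mathbf{a} \mid A\Rightarrow B \mid \forall a.A$ with disjoint sets of type-variables $a$ and eigenvariables $\mathbf{a}$ (eigenvariables cannot be instantiated by substitution). Metaterms of $\lambda^{\mathsf F}_{\mathfrak m}$: $M,N ::= x \mid \lambda x.M \mid M\,N \mid \Lambda a.M \mid M\,A \mid \star \mid (M\triangleright N) \mid \mathrm{gen}_A \mid \mathrm{ver}_A(M) \mid \nu\mathbf{a}.M$ (up to $\alpha$-renaming; $\nu\mathbf{a}$ binds $\mathbf{a}$). Reduction $\to$ is the closure under arbitrary contexts of: (1) $(\lambda x.M)N\to M\{x:=N\}$; (2) $(\Lambda a.M)A\to M\{a:=A\}$; (3) $(\star\triangleright M)\to M$; (4) $\mathrm{ver}_{\mathbf{a}}(\mathrm{gen}_{\mathbf{a}})\to\star$ for eigenvariables $\mathbf{a}$; (5) $\mathrm{gen}_{A\Rightarrow B}\to\lambda x.(\mathrm{ver}_A(x)\triangleright\mathrm{gen}_B)$; (6) $\mathrm{ver}_{A\Rightarrow B}(M)\to\mathrm{ver}_B(M\,\mathrm{gen}_A)$; (7) $\mathrm{gen}_{\forall a.A}\to\Lambda a.\mathrm{gen}_A$; (8) $\mathrm{ver}_{\forall a.A}(M)\to\nu\mathbf{a}.\mathrm{ver}_{A\{a:=\mathbf{a}\}}(M\,\mathbf{a})$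 with $\mathbf{a}$ fresh; (9) $\nu\mathbf{a}.M\to M$ if $\mathbf{a}$ not free in $M$. $\twoheadrightarrow$ is the reflexive-transitive closure. -}

module Defs where

open import Data.Nat using (ℕ; zero; suc)
open import Relation.Binary.Construct.Closure.ReflexiveTransitive using (Star)

-- Three separate index spaces: term variables x (bound by λ),
-- type variables a (bound by ∀ and Λ), eigenvariables 𝐚 (bound by ν).

data Ty : Set where
  tv   : ℕ → Ty
  ev   : ℕ → Ty
  _⇒_  : Ty → Ty → Ty
  all  : Ty → Ty

infixr 7 _⇒_

ext : (ℕ → ℕ) → ℕ → ℕ
ext ρ zero    = zero
ext ρ (suc n) = suc (ρ n)

trenT : (ℕ → ℕ) → Ty → Ty
trenT ρ (tv n)  = tv (ρ n)
trenT ρ (ev n)  = ev n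
trenT ρ (A ⇒ B) = trenT ρ A ⇒ trenT ρ B
trenT ρ (all A) = all (trenT (ext ρ) A)

erenT : (ℕ → ℕ) → Ty → Ty
erenT ρ (tv n)  = tv n
erenT ρ (ev n)  = ev (ρ n)
erenT ρ (A ⇒ B) = erenT ρ A ⇒ erenT ρ B
erenT ρ (all A) = all (erenT ρ A)

extsT : (ℕ → Ty) → ℕ → Ty
extsT σ zero    = tv zero
extsT σ (suc n) = trenT suc (σ n)

tsubT : (ℕ → Ty) → Ty → Ty
tsubT σ (tv n)  = σ n
tsubT σ (ev n)  = ev n
tsubT σ (A ⇒ B) = tsubT σ A ⇒ tsubT σ B
tsubT σ (all A) = all (tsubT (extsT σ) A)

_•T_ : Ty → ℕ → Ty
(A •T zero)  = A
(A •T suc n) = tv n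

data Tm : Set where
  var  : ℕ → Tm
  lam  : Tm → Tm
  app  : Tm → Tm → Tm
  Lam  : Tm → Tm
  tapp : Tm → Ty → Tm
  star : Tm
  tri  : Tm → Tm → Tm
  gen  : Ty → Tm
  ver  : Ty → Tm → Tm
  nu   : Tm → Tm

ren : (ℕ → ℕ) → Tm → Tm
ren ρ (var n)    = var (ρ n)
ren ρ (lam M)    = lam (ren (ext ρ) M)
ren ρ (app M N)  = app (ren ρ M) (ren ρ N)
ren ρ (Lam M)    = Lam (ren ρ M)
ren ρ (tapp M A) = tapp (ren ρ M) A
ren ρ star       = star
ren ρ (tri M N)  = tri (ren ρ M) (ren ρ N)
ren ρ (gen A)    = gen A
ren ρ (ver A M)  = ver A (ren ρ M)
ren ρ (nu M)     = nu (ren ρ M)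

tren : (ℕ → ℕ) → Tm → Tm
tren ρ (var n)    = var n
tren ρ (lam M)    = lam (tren ρ M)
tren ρ (app M N)  = app (tren ρ M) (tren ρ N)
tren ρ (Lam M)    = Lam (tren (ext ρ) M)
tren ρ (tapp M A) = tapp (tren ρ M) (trenT ρ A)
tren ρ star       = star
tren ρ (tri M N)  = tri (tren ρ M) (tren ρ N)
tren ρ (gen A)    = gen (trenT ρ A)
tren ρ (ver A M)  = ver (trenT ρ A) (tren ρ M)
tren ρ (nu M)     = nu (tren ρ M)

eren : (ℕ → ℕ) → Tm → Tm
eren ρ (var n)    = var n
eren ρ (lam M)    = lam (eren ρ M)
eren ρ (app M N)  = app (eren ρ M) (eren ρ N)
eren ρ (Lam M)    = Lam (eren ρ M)
eren ρ (tapp M A) = tapp (eren ρ M) (erenT ρ A)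
eren ρ star       = star
eren ρ (tri M N)  = tri (eren ρ M) (eren ρ N)
eren ρ (gen A)    = gen (erenT ρ A)
eren ρ (ver A M)  = ver (erenT ρ A) (eren ρ M)
eren ρ (nu M)     = nu (eren (ext ρ) M)

tsub : (ℕ → Ty) → Tm → Tm
tsub σ (var n)    = var n
tsub σ (lam M)    = lam (tsub σ M)
tsub σ (app M N)  = app (tsub σ M) (tsub σ N)
tsub σ (Lam M)    = Lam (tsub (extsT σ) M)
tsub σ (tapp M A) = tapp (tsub σ M) (tsubT σ A)
tsub σ star       = star
tsub σ (tri M N)  = tri (tsub σ M) (tsub σ N)
tsub σ (gen A)    = gen (tsubT σ A)
tsub σ (ver A M)  = ver (tsubT σ A) (tsub σ M)
tsub σ (nu M)     = nu (tsub (λ n → erenT suc (σ n)) M)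

exts : (ℕ → Tm) → ℕ → Tm
exts σ zero    = var zero
exts σ (suc n) = ren suc (σ n)

sub : (ℕ → Tm) → Tm → Tm
sub σ (var n)    = σ n
sub σ (lam M)    = lam (sub (exts σ) M)
sub σ (app M N)  = app (sub σ M) (sub σ N)
sub σ (Lam M)    = Lam (sub (λ n → tren suc (σ n)) M)
sub σ (tapp M A) = tapp (sub σ M) A
sub σ star       = star
sub σ (tri M N)  = tri (sub σ M) (sub σ N)
sub σ (gen A)    = gen A
sub σ (ver A M)  = ver A (sub σ M)
sub σ (nu M)     = nu (sub (λ n → eren suc (σ n)) M)

_•_ : Tm → ℕ → Tm
(N • zero)  = N
(N • suc n) = var n

-- A{a := 𝐚} for the body A of ∀a.A, with 𝐚 a fresh eigenvariable (index 0)
instEv : Ty → Ty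
instEv A = tsubT (ev zero •T_) (erenT suc A)

data _⟶_ : Tm → Tm → Set where
  β     : ∀ {M N} → app (lam M) N ⟶ sub (N •_) M
  βT    : ∀ {M A} → tapp (Lam M) A ⟶ tsub (A •T_) M
  ▷⋆    : ∀ {M} → tri star M ⟶ M
  verEv : ∀ {i} → ver (ev i) (gen (ev i)) ⟶ star
  gen⇒  : ∀ {A B} → gen (A ⇒ B) ⟶ lam (tri (ver A (var zero)) (gen B))
  ver⇒  : ∀ {A B M} → ver (A ⇒ B) M ⟶ ver B (app M (gen A))
  gen∀  : ∀ {A} → gen (all A) ⟶ Lam (gen A)
  ver∀  : ∀ {A M} → ver (all A) M ⟶ nu (ver (instEv A) (tapp (eren suc M) (ev zero)))
  νgc   : ∀ {M} → nu (eren suc M) ⟶ M       -- ν𝐚.M → M when 𝐚 ∉ FV(M)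
  ξlam  : ∀ {M M'} → M ⟶ M' → lam M ⟶ lam M'
  ξappₗ : ∀ {M M' N} → M ⟶ M' → app M N ⟶ app M' N
  ξappᵣ : ∀ {M N N'} → N ⟶ N' → app M N ⟶ app M N'
  ξLam  : ∀ {M M'} → M ⟶ M' → Lam M ⟶ Lam M'
  ξtapp : ∀ {M M' A} → M ⟶ M' → tapp M A ⟶ tapp M' A
  ξtriₗ : ∀ {M M' N} → M ⟶ M' → tri M N ⟶ tri M' N
  ξtriᵣ : ∀ {M N N'} → N ⟶ N' → tri M N ⟶ tri M N'
  ξver  : ∀ {A M M'} → M ⟶ M' → ver A M ⟶ ver A M'
  ξnu   : ∀ {M M'} → M ⟶ M' → nu M ⟶ nu M'

infix 4 _⟶_ _↠_

_↠_ : Tm → Tm → Set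
_↠_ = Star _⟶_

-- Parallel reduction ⇛ contracts any set of redexes of a term at once, so that
-- ⟶ ⊆ ⇛ ⊆ ↠ and it suffices to show that ⇛ has the diamond property.  Each
-- critical pair is closed by contracting the remaining redexes; this needs ⇛ to be
-- stable under all renamings and substitutions.  The rule ν𝐚.M ⟶ M with 𝐚 ∉ FV(M)
-- is not purely syntactic, and the one extra fact it requires is that ⇛ never
-- creates free eigenvariables, so the side condition survives reduction.  The
-- non-left-linear rule ver_𝐚(gen_𝐚) ⟶ ⋆ causes no trouble because gen_𝐚 is normal.
module Submission where

open import Defs
open import Data.Nat using (ℕ; zero; suc; pred; NonZero; nonZero)
open import Data.Nat.Properties using (suc-pred)
open import Data.Product using (∃; _×_; _,_)
open import Data.Unit using (⊤; tt)
open import Function using (_∘_; id)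
open import Relation.Binary.Core using (Rel) renaming (_⇒_ to _⊆_)
open import Relation.Binary.PropositionalEquality hiding ([_])
open import Relation.Binary.Construct.Closure.ReflexiveTransitive
  using (Star; ε; _◅_; _◅◅_; gmap; map; return; _⋆)
open import Relation.Binary.Rewriting using (Confluent)
open ≡-Reasoning

-- Confluence via a relation with the diamond property

Joinable : ∀ {a ℓ} {A : Set a} → Rel A ℓ → Rel A _
Joinable R N₁ N₂ = ∃ λ P → R N₁ P × R N₂ P

Diamond : ∀ {a ℓ} {A : Set a} → Rel A ℓ → Set _
Diamond R = ∀ {M N₁ N₂} → R M N₁ → R M N₂ → Joinable R N₁ N₂

module _ {a ℓ} {A : Set a} {R : Rel A ℓ} (diamond : Diamond R) where

  diamond-strip : ∀ {M N₁ N₂} → R M N₁ → Star R M N₂ → ∃ λ P → Star R N₁ P × R N₂ P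
  diamond-strip r ε = _ , ε , r
  diamond-strip r (s ◅ ss) =
    let P , r′ , s′ = diamond r s
        Q , rs , s″ = diamond-strip s′ ss
    in Q , r′ ◅ rs , s″

  diamond⇒confluent : Confluent R
  diamond⇒confluent ε ss = _ , ss , ε
  diamond⇒confluent (r ◅ rs) ss =
    let P , ss′ , r′ = diamond-strip r ss
        Q , rs′ , ss″ = diamond⇒confluent rs ss′
    in Q , rs′ , r′ ◅ ss″

confluent-between : ∀ {a ℓ₁ ℓ₂} {A : Set a} {R : Rel A ℓ₁} {S : Rel A ℓ₂} →
                    R ⊆ S → S ⊆ Star R → Confluent S → Confluent R
confluent-between R⊆S S⊆R* confluent r₁ r₂ =
  let P , s₁ , s₂ = confluent (map R⊆S r₁) (map R⊆S r₂)
  in P , (S⊆R* ⋆) s₁ , (S⊆R* ⋆) s₂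

-- Renaming and substitution in types

ext-cong : ∀ {ρ ρ′} → ρ ≗ ρ′ → ext ρ ≗ ext ρ′
ext-cong h zero    = refl
ext-cong h (suc n) = cong suc (h n)

ext-∘ : ∀ ρ ρ′ → ext ρ ∘ ext ρ′ ≗ ext (ρ ∘ ρ′)
ext-∘ ρ ρ′ zero    = refl
ext-∘ ρ ρ′ (suc n) = refl

trenT-cong : ∀ {ρ ρ′} → ρ ≗ ρ′ → ∀ A → trenT ρ A ≡ trenT ρ′ A
trenT-cong h (tv n)  = cong tv (h n)
trenT-cong h (ev n)  = refl
trenT-cong h (A ⇒ B) = cong₂ _⇒_ (trenT-cong h A) (trenT-cong h B)
trenT-cong h (all A) = cong all (trenT-cong (ext-cong h) A)

erenT-cong : ∀ {ρ ρ′} → ρ ≗ ρ′ → ∀ A → erenT ρ A ≡ erenT ρ′ A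
erenT-cong h (tv n)  = refl
erenT-cong h (ev n)  = cong ev (h n)
erenT-cong h (A ⇒ B) = cong₂ _⇒_ (erenT-cong h A) (erenT-cong h B)
erenT-cong h (all A) = cong all (erenT-cong h A)

extsT-cong : ∀ {σ σ′} → σ ≗ σ′ → extsT σ ≗ extsT σ′
extsT-cong h zero    = refl
extsT-cong h (suc n) = cong (trenT suc) (h n)

tsubT-cong : ∀ {σ σ′} → σ ≗ σ′ → ∀ A → tsubT σ A ≡ tsubT σ′ A
tsubT-cong h (tv n)  = h n
tsubT-cong h (ev n)  = refl
tsubT-cong h (A ⇒ B) = cong₂ _⇒_ (tsubT-cong h A) (tsubT-cong h B)
tsubT-cong h (all A) = cong all (tsubT-cong (extsT-cong h) A)

trenT-trenT : ∀ ρ ρ′ A → trenT ρ (trenT ρ′ A) ≡ trenT (ρ ∘ ρ′) A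
trenT-trenT ρ ρ′ (tv n)  = refl
trenT-trenT ρ ρ′ (ev n)  = refl
trenT-trenT ρ ρ′ (A ⇒ B) = cong₂ _⇒_ (trenT-trenT ρ ρ′ A) (trenT-trenT ρ ρ′ B)
trenT-trenT ρ ρ′ (all A) =
  cong all (trans (trenT-trenT (ext ρ) (ext ρ′) A) (trenT-cong (ext-∘ ρ ρ′) A))

extsT-ext : ∀ σ ρ → extsT σ ∘ ext ρ ≗ extsT (σ ∘ ρ)
extsT-ext σ ρ zero    = refl
extsT-ext σ ρ (suc n) = refl

tsubT-trenT : ∀ σ ρ A → tsubT σ (trenT ρ A) ≡ tsubT (σ ∘ ρ) A
tsubT-trenT σ ρ (tv n)  = refl
tsubT-trenT σ ρ (ev n)  = refl
tsubT-trenT σ ρ (A ⇒ B) = cong₂ _⇒_ (tsubT-trenT σ ρ A) (tsubT-trenT σ ρ B)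
tsubT-trenT σ ρ (all A) =
  cong all (trans (tsubT-trenT (extsT σ) (ext ρ) A) (tsubT-cong (extsT-ext σ ρ) A))

extsT-trenT : ∀ ρ σ → trenT (ext ρ) ∘ extsT σ ≗ extsT (trenT ρ ∘ σ)
extsT-trenT ρ σ zero    = refl
extsT-trenT ρ σ (suc n) = trans (trenT-trenT (ext ρ) suc (σ n)) (sym (trenT-trenT suc ρ (σ n)))

trenT-tsubT : ∀ ρ σ A → trenT ρ (tsubT σ A) ≡ tsubT (trenT ρ ∘ σ) A
trenT-tsubT ρ σ (tv n)  = refl
trenT-tsubT ρ σ (ev n)  = refl
trenT-tsubT ρ σ (A ⇒ B) = cong₂ _⇒_ (trenT-tsubT ρ σ A) (trenT-tsubT ρ σ B)
trenT-tsubT ρ σ (all A) =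
  cong all (trans (trenT-tsubT (ext ρ) (extsT σ) A) (tsubT-cong (extsT-trenT ρ σ) A))

extsT-tsubT : ∀ σ τ → tsubT (extsT σ) ∘ extsT τ ≗ extsT (tsubT σ ∘ τ)
extsT-tsubT σ τ zero    = refl
extsT-tsubT σ τ (suc n) = trans (tsubT-trenT (extsT σ) suc (τ n)) (sym (trenT-tsubT suc σ (τ n)))

tsubT-tsubT : ∀ σ τ A → tsubT σ (tsubT τ A) ≡ tsubT (tsubT σ ∘ τ) A
tsubT-tsubT σ τ (tv n)  = refl
tsubT-tsubT σ τ (ev n)  = refl
tsubT-tsubT σ τ (A ⇒ B) = cong₂ _⇒_ (tsubT-tsubT σ τ A) (tsubT-tsubT σ τ B)
tsubT-tsubT σ τ (all A) =
  cong all (trans (tsubT-tsubT (extsT σ) (extsT τ) A) (tsubT-cong (extsT-tsubT σ τ) A))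

extsT-id : ∀ {σ} → σ ≗ tv → extsT σ ≗ tv
extsT-id h zero    = refl
extsT-id h (suc n) = cong (trenT suc) (h n)

tsubT-id : ∀ {σ} → σ ≗ tv → ∀ A → tsubT σ A ≡ A
tsubT-id h (tv n)  = h n
tsubT-id h (ev n)  = refl
tsubT-id h (A ⇒ B) = cong₂ _⇒_ (tsubT-id h A) (tsubT-id h B)
tsubT-id h (all A) = cong all (tsubT-id (extsT-id h) A)

tsubT-•T-trenT : ∀ A B → tsubT (A •T_) (trenT suc B) ≡ B
tsubT-•T-trenT A B = trans (tsubT-trenT (A •T_) suc B) (tsubT-id (λ _ → refl) B)

extsT-tv : ∀ ρ → tv ∘ ext ρ ≗ extsT (tv ∘ ρ)
extsT-tv ρ zero    = refl
extsT-tv ρ (suc n) = refl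

trenT-as-tsubT : ∀ ρ A → trenT ρ A ≡ tsubT (tv ∘ ρ) A
trenT-as-tsubT ρ (tv n)  = refl
trenT-as-tsubT ρ (ev n)  = refl
trenT-as-tsubT ρ (A ⇒ B) = cong₂ _⇒_ (trenT-as-tsubT ρ A) (trenT-as-tsubT ρ B)
trenT-as-tsubT ρ (all A) =
  cong all (trans (trenT-as-tsubT (ext ρ) A) (tsubT-cong (extsT-tv ρ) A))

erenT-trenT : ∀ ρ ρ′ A → erenT ρ (trenT ρ′ A) ≡ trenT ρ′ (erenT ρ A)
erenT-trenT ρ ρ′ (tv n)  = refl
erenT-trenT ρ ρ′ (ev n)  = refl
erenT-trenT ρ ρ′ (A ⇒ B) = cong₂ _⇒_ (erenT-trenT ρ ρ′ A) (erenT-trenT ρ ρ′ B)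
erenT-trenT ρ ρ′ (all A) = cong all (erenT-trenT ρ (ext ρ′) A)

extsT-erenT : ∀ ρ σ → erenT ρ ∘ extsT σ ≗ extsT (erenT ρ ∘ σ)
extsT-erenT ρ σ zero    = refl
extsT-erenT ρ σ (suc n) = erenT-trenT ρ suc (σ n)

erenT-tsubT : ∀ ρ σ A → erenT ρ (tsubT σ A) ≡ tsubT (erenT ρ ∘ σ) (erenT ρ A)
erenT-tsubT ρ σ (tv n)  = refl
erenT-tsubT ρ σ (ev n)  = refl
erenT-tsubT ρ σ (A ⇒ B) = cong₂ _⇒_ (erenT-tsubT ρ σ A) (erenT-tsubT ρ σ B)
erenT-tsubT ρ σ (all A) =
  cong all (trans (erenT-tsubT ρ (extsT σ) A) (tsubT-cong (extsT-erenT ρ σ) (erenT ρ A)))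

erenT-erenT : ∀ ρ ρ′ A → erenT ρ (erenT ρ′ A) ≡ erenT (ρ ∘ ρ′) A
erenT-erenT ρ ρ′ (tv n)  = refl
erenT-erenT ρ ρ′ (ev n)  = refl
erenT-erenT ρ ρ′ (A ⇒ B) = cong₂ _⇒_ (erenT-erenT ρ ρ′ A) (erenT-erenT ρ ρ′ B)
erenT-erenT ρ ρ′ (all A) = cong all (erenT-erenT ρ ρ′ A)

erenT-id : ∀ A → erenT id A ≡ A
erenT-id (tv n)  = refl
erenT-id (ev n)  = refl
erenT-id (A ⇒ B) = cong₂ _⇒_ (erenT-id A) (erenT-id B)
erenT-id (all A) = cong all (erenT-id A)

tsubT-instEv : ∀ τ A → tsubT (erenT suc ∘ τ) (instEv A) ≡ instEv (tsubT (extsT τ) A)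
tsubT-instEv τ A = begin
  tsubT (erenT suc ∘ τ) (tsubT (ev zero •T_) (erenT suc A))
    ≡⟨ tsubT-tsubT _ _ (erenT suc A) ⟩
  tsubT (tsubT (erenT suc ∘ τ) ∘ (ev zero •T_)) (erenT suc A)
    ≡⟨ tsubT-cong pointwise (erenT suc A) ⟩
  tsubT (tsubT (ev zero •T_) ∘ erenT suc ∘ extsT τ) (erenT suc A)
    ≡⟨ tsubT-tsubT _ _ (erenT suc A) ⟨
  tsubT (ev zero •T_) (tsubT (erenT suc ∘ extsT τ) (erenT suc A))
    ≡⟨ cong (tsubT (ev zero •T_)) (erenT-tsubT suc (extsT τ) A) ⟨
  tsubT (ev zero •T_) (erenT suc (tsubT (extsT τ) A)) ∎
  where
  pointwise : tsubT (erenT suc ∘ τ) ∘ (ev zero •T_) ≗ tsubT (ev zero •T_) ∘ erenT suc ∘ extsT τ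
  pointwise zero    = refl
  pointwise (suc n) = sym (trans (cong (tsubT (ev zero •T_)) (erenT-trenT suc suc (τ n)))
                                 (tsubT-•T-trenT (ev zero) (erenT suc (τ n))))

erenT-instEv : ∀ ρ A → erenT (ext ρ) (instEv A) ≡ instEv (erenT ρ A)
erenT-instEv ρ A = begin
  erenT (ext ρ) (tsubT (ev zero •T_) (erenT suc A))
    ≡⟨ erenT-tsubT (ext ρ) (ev zero •T_) (erenT suc A) ⟩
  tsubT (erenT (ext ρ) ∘ (ev zero •T_)) (erenT (ext ρ) (erenT suc A))
    ≡⟨ tsubT-cong (λ { zero → refl ; (suc n) → refl }) (erenT (ext ρ) (erenT suc A)) ⟩
  tsubT (ev zero •T_) (erenT (ext ρ) (erenT suc A))
    ≡⟨ cong (tsubT (ev zero •T_)) (erenT-erenT (ext ρ) suc A) ⟩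
  tsubT (ev zero •T_) (erenT (suc ∘ ρ) A)
    ≡⟨ cong (tsubT (ev zero •T_)) (erenT-erenT suc ρ A) ⟨
  tsubT (ev zero •T_) (erenT suc (erenT ρ A)) ∎

-- Renaming and substitution in terms

ren-cong : ∀ {ρ ρ′} → ρ ≗ ρ′ → ∀ M → ren ρ M ≡ ren ρ′ M
ren-cong h (var n)    = cong var (h n)
ren-cong h (lam M)    = cong lam (ren-cong (ext-cong h) M)
ren-cong h (app M N)  = cong₂ app (ren-cong h M) (ren-cong h N)
ren-cong h (Lam M)    = cong Lam (ren-cong h M)
ren-cong h (tapp M A) = cong (λ X → tapp X A) (ren-cong h M)
ren-cong h star       = refl
ren-cong h (tri M N)  = cong₂ tri (ren-cong h M) (ren-cong h N)
ren-cong h (gen A)    = refl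
ren-cong h (ver A M)  = cong (ver A) (ren-cong h M)
ren-cong h (nu M)     = cong nu (ren-cong h M)

eren-cong : ∀ {ρ ρ′} → ρ ≗ ρ′ → ∀ M → eren ρ M ≡ eren ρ′ M
eren-cong h (var n)    = refl
eren-cong h (lam M)    = cong lam (eren-cong h M)
eren-cong h (app M N)  = cong₂ app (eren-cong h M) (eren-cong h N)
eren-cong h (Lam M)    = cong Lam (eren-cong h M)
eren-cong h (tapp M A) = cong₂ tapp (eren-cong h M) (erenT-cong h A)
eren-cong h star       = refl
eren-cong h (tri M N)  = cong₂ tri (eren-cong h M) (eren-cong h N)
eren-cong h (gen A)    = cong gen (erenT-cong h A)
eren-cong h (ver A M)  = cong₂ ver (erenT-cong h A) (eren-cong h M)
eren-cong h (nu M)     = cong nu (eren-cong (ext-cong h) M)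

tsub-cong : ∀ {σ σ′} → σ ≗ σ′ → ∀ M → tsub σ M ≡ tsub σ′ M
tsub-cong h (var n)    = refl
tsub-cong h (lam M)    = cong lam (tsub-cong h M)
tsub-cong h (app M N)  = cong₂ app (tsub-cong h M) (tsub-cong h N)
tsub-cong h (Lam M)    = cong Lam (tsub-cong (extsT-cong h) M)
tsub-cong h (tapp M A) = cong₂ tapp (tsub-cong h M) (tsubT-cong h A)
tsub-cong h star       = refl
tsub-cong h (tri M N)  = cong₂ tri (tsub-cong h M) (tsub-cong h N)
tsub-cong h (gen A)    = cong gen (tsubT-cong h A)
tsub-cong h (ver A M)  = cong₂ ver (tsubT-cong h A) (tsub-cong h M)
tsub-cong h (nu M)     = cong nu (tsub-cong (cong (erenT suc) ∘ h) M)

exts-cong : ∀ {σ σ′} → σ ≗ σ′ → exts σ ≗ exts σ′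
exts-cong h zero    = refl
exts-cong h (suc n) = cong (ren suc) (h n)

sub-cong : ∀ {σ σ′} → σ ≗ σ′ → ∀ M → sub σ M ≡ sub σ′ M
sub-cong h (var n)    = h n
sub-cong h (lam M)    = cong lam (sub-cong (exts-cong h) M)
sub-cong h (app M N)  = cong₂ app (sub-cong h M) (sub-cong h N)
sub-cong h (Lam M)    = cong Lam (sub-cong (cong (tren suc) ∘ h) M)
sub-cong h (tapp M A) = cong (λ X → tapp X A) (sub-cong h M)
sub-cong h star       = refl
sub-cong h (tri M N)  = cong₂ tri (sub-cong h M) (sub-cong h N)
sub-cong h (gen A)    = refl
sub-cong h (ver A M)  = cong (ver A) (sub-cong h M)
sub-cong h (nu M)     = cong nu (sub-cong (cong (eren suc) ∘ h) M)

tsub-tsub : ∀ σ τ M → tsub σ (tsub τ M) ≡ tsub (tsubT σ ∘ τ) M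
tsub-tsub σ τ (var n)    = refl
tsub-tsub σ τ (lam M)    = cong lam (tsub-tsub σ τ M)
tsub-tsub σ τ (app M N)  = cong₂ app (tsub-tsub σ τ M) (tsub-tsub σ τ N)
tsub-tsub σ τ (Lam M)    =
  cong Lam (trans (tsub-tsub (extsT σ) (extsT τ) M) (tsub-cong (extsT-tsubT σ τ) M))
tsub-tsub σ τ (tapp M A) = cong₂ tapp (tsub-tsub σ τ M) (tsubT-tsubT σ τ A)
tsub-tsub σ τ star       = refl
tsub-tsub σ τ (tri M N)  = cong₂ tri (tsub-tsub σ τ M) (tsub-tsub σ τ N)
tsub-tsub σ τ (gen A)    = cong gen (tsubT-tsubT σ τ A)
tsub-tsub σ τ (ver A M)  = cong₂ ver (tsubT-tsubT σ τ A) (tsub-tsub σ τ M)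
tsub-tsub σ τ (nu M)     = cong nu (trans (tsub-tsub (erenT suc ∘ σ) (erenT suc ∘ τ) M)
  (tsub-cong (λ n → sym (erenT-tsubT suc σ (τ n))) M))

tsub-id : ∀ {σ} → σ ≗ tv → ∀ M → tsub σ M ≡ M
tsub-id h (var n)    = refl
tsub-id h (lam M)    = cong lam (tsub-id h M)
tsub-id h (app M N)  = cong₂ app (tsub-id h M) (tsub-id h N)
tsub-id h (Lam M)    = cong Lam (tsub-id (extsT-id h) M)
tsub-id h (tapp M A) = cong₂ tapp (tsub-id h M) (tsubT-id h A)
tsub-id h star       = refl
tsub-id h (tri M N)  = cong₂ tri (tsub-id h M) (tsub-id h N)
tsub-id h (gen A)    = cong gen (tsubT-id h A)
tsub-id h (ver A M)  = cong₂ ver (tsubT-id h A) (tsub-id h M)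
tsub-id h (nu M)     = cong nu (tsub-id (cong (erenT suc) ∘ h) M)

tren-as-tsub : ∀ ρ M → tren ρ M ≡ tsub (tv ∘ ρ) M
tren-as-tsub ρ (var n)    = refl
tren-as-tsub ρ (lam M)    = cong lam (tren-as-tsub ρ M)
tren-as-tsub ρ (app M N)  = cong₂ app (tren-as-tsub ρ M) (tren-as-tsub ρ N)
tren-as-tsub ρ (Lam M)    = cong Lam (trans (tren-as-tsub (ext ρ) M) (tsub-cong (extsT-tv ρ) M))
tren-as-tsub ρ (tapp M A) = cong₂ tapp (tren-as-tsub ρ M) (trenT-as-tsubT ρ A)
tren-as-tsub ρ star       = refl
tren-as-tsub ρ (tri M N)  = cong₂ tri (tren-as-tsub ρ M) (tren-as-tsub ρ N)
tren-as-tsub ρ (gen A)    = cong gen (trenT-as-tsubT ρ A)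
tren-as-tsub ρ (ver A M)  = cong₂ ver (trenT-as-tsubT ρ A) (tren-as-tsub ρ M)
tren-as-tsub ρ (nu M)     = cong nu (tren-as-tsub ρ M)

tsub-extsT-tren : ∀ τ M → tsub (extsT τ) (tren suc M) ≡ tren suc (tsub τ M)
tsub-extsT-tren τ M = begin
  tsub (extsT τ) (tren suc M)          ≡⟨ cong (tsub (extsT τ)) (tren-as-tsub suc M) ⟩
  tsub (extsT τ) (tsub (tv ∘ suc) M)   ≡⟨ tsub-tsub (extsT τ) (tv ∘ suc) M ⟩
  tsub (trenT suc ∘ τ) M               ≡⟨ tsub-cong (trenT-as-tsubT suc ∘ τ) M ⟩
  tsub (tsubT (tv ∘ suc) ∘ τ) M        ≡⟨ tsub-tsub (tv ∘ suc) τ M ⟨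
  tsub (tv ∘ suc) (tsub τ M)           ≡⟨ tren-as-tsub suc (tsub τ M) ⟨
  tren suc (tsub τ M)                  ∎

tsub-•T-tren : ∀ A M → tsub (A •T_) (tren suc M) ≡ M
tsub-•T-tren A M = begin
  tsub (A •T_) (tren suc M)          ≡⟨ cong (tsub (A •T_)) (tren-as-tsub suc M) ⟩
  tsub (A •T_) (tsub (tv ∘ suc) M)   ≡⟨ tsub-tsub (A •T_) (tv ∘ suc) M ⟩
  tsub tv M                          ≡⟨ tsub-id (λ _ → refl) M ⟩
  M                                  ∎

eren-eren : ∀ ρ ρ′ M → eren ρ (eren ρ′ M) ≡ eren (ρ ∘ ρ′) M
eren-eren ρ ρ′ (var n)    = refl
eren-eren ρ ρ′ (lam M)    = cong lam (eren-eren ρ ρ′ M)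
eren-eren ρ ρ′ (app M N)  = cong₂ app (eren-eren ρ ρ′ M) (eren-eren ρ ρ′ N)
eren-eren ρ ρ′ (Lam M)    = cong Lam (eren-eren ρ ρ′ M)
eren-eren ρ ρ′ (tapp M A) = cong₂ tapp (eren-eren ρ ρ′ M) (erenT-erenT ρ ρ′ A)
eren-eren ρ ρ′ star       = refl
eren-eren ρ ρ′ (tri M N)  = cong₂ tri (eren-eren ρ ρ′ M) (eren-eren ρ ρ′ N)
eren-eren ρ ρ′ (gen A)    = cong gen (erenT-erenT ρ ρ′ A)
eren-eren ρ ρ′ (ver A M)  = cong₂ ver (erenT-erenT ρ ρ′ A) (eren-eren ρ ρ′ M)
eren-eren ρ ρ′ (nu M)     =
  cong nu (trans (eren-eren (ext ρ) (ext ρ′) M) (eren-cong (ext-∘ ρ ρ′) M))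

eren-ext-suc : ∀ ρ M → eren (ext ρ) (eren suc M) ≡ eren suc (eren ρ M)
eren-ext-suc ρ M = trans (eren-eren (ext ρ) suc M) (sym (eren-eren suc ρ M))

eren-tsub : ∀ ρ τ M → eren ρ (tsub τ M) ≡ tsub (erenT ρ ∘ τ) (eren ρ M)
eren-tsub ρ τ (var n)    = refl
eren-tsub ρ τ (lam M)    = cong lam (eren-tsub ρ τ M)
eren-tsub ρ τ (app M N)  = cong₂ app (eren-tsub ρ τ M) (eren-tsub ρ τ N)
eren-tsub ρ τ (Lam M)    =
  cong Lam (trans (eren-tsub ρ (extsT τ) M) (tsub-cong (extsT-erenT ρ τ) (eren ρ M)))
eren-tsub ρ τ (tapp M A) = cong₂ tapp (eren-tsub ρ τ M) (erenT-tsubT ρ τ A)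
eren-tsub ρ τ star       = refl
eren-tsub ρ τ (tri M N)  = cong₂ tri (eren-tsub ρ τ M) (eren-tsub ρ τ N)
eren-tsub ρ τ (gen A)    = cong gen (erenT-tsubT ρ τ A)
eren-tsub ρ τ (ver A M)  = cong₂ ver (erenT-tsubT ρ τ A) (eren-tsub ρ τ M)
eren-tsub ρ τ (nu M)     = cong nu (trans (eren-tsub (ext ρ) (erenT suc ∘ τ) M)
  (tsub-cong (λ n → trans (erenT-erenT (ext ρ) suc (τ n)) (sym (erenT-erenT suc ρ (τ n))))
             (eren (ext ρ) M)))

eren-id : ∀ M → eren id M ≡ M
eren-id (var n)    = refl
eren-id (lam M)    = cong lam (eren-id M)
eren-id (app M N)  = cong₂ app (eren-id M) (eren-id N)
eren-id (Lam M)    = cong Lam (eren-id M)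
eren-id (tapp M A) = cong₂ tapp (eren-id M) (erenT-id A)
eren-id star       = refl
eren-id (tri M N)  = cong₂ tri (eren-id M) (eren-id N)
eren-id (gen A)    = cong gen (erenT-id A)
eren-id (ver A M)  = cong₂ ver (erenT-id A) (eren-id M)
eren-id (nu M)     = cong nu (trans (eren-cong (λ { zero → refl ; (suc n) → refl }) M) (eren-id M))

ren-ren : ∀ ρ ρ′ M → ren ρ (ren ρ′ M) ≡ ren (ρ ∘ ρ′) M
ren-ren ρ ρ′ (var n)    = refl
ren-ren ρ ρ′ (lam M)    = cong lam (trans (ren-ren (ext ρ) (ext ρ′) M) (ren-cong (ext-∘ ρ ρ′) M))
ren-ren ρ ρ′ (app M N)  = cong₂ app (ren-ren ρ ρ′ M) (ren-ren ρ ρ′ N)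
ren-ren ρ ρ′ (Lam M)    = cong Lam (ren-ren ρ ρ′ M)
ren-ren ρ ρ′ (tapp M A) = cong (λ X → tapp X A) (ren-ren ρ ρ′ M)
ren-ren ρ ρ′ star       = refl
ren-ren ρ ρ′ (tri M N)  = cong₂ tri (ren-ren ρ ρ′ M) (ren-ren ρ ρ′ N)
ren-ren ρ ρ′ (gen A)    = refl
ren-ren ρ ρ′ (ver A M)  = cong (ver A) (ren-ren ρ ρ′ M)
ren-ren ρ ρ′ (nu M)     = cong nu (ren-ren ρ ρ′ M)

exts-ext : ∀ σ ρ → exts σ ∘ ext ρ ≗ exts (σ ∘ ρ)
exts-ext σ ρ zero    = refl
exts-ext σ ρ (suc n) = refl

sub-ren : ∀ σ ρ M → sub σ (ren ρ M) ≡ sub (σ ∘ ρ) M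
sub-ren σ ρ (var n)    = refl
sub-ren σ ρ (lam M)    = cong lam (trans (sub-ren (exts σ) (ext ρ) M) (sub-cong (exts-ext σ ρ) M))
sub-ren σ ρ (app M N)  = cong₂ app (sub-ren σ ρ M) (sub-ren σ ρ N)
sub-ren σ ρ (Lam M)    = cong Lam (sub-ren (tren suc ∘ σ) ρ M)
sub-ren σ ρ (tapp M A) = cong (λ X → tapp X A) (sub-ren σ ρ M)
sub-ren σ ρ star       = refl
sub-ren σ ρ (tri M N)  = cong₂ tri (sub-ren σ ρ M) (sub-ren σ ρ N)
sub-ren σ ρ (gen A)    = refl
sub-ren σ ρ (ver A M)  = cong (ver A) (sub-ren σ ρ M)
sub-ren σ ρ (nu M)     = cong nu (sub-ren (eren suc ∘ σ) ρ M)

ren-tsub : ∀ ρ τ M → ren ρ (tsub τ M) ≡ tsub τ (ren ρ M)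
ren-tsub ρ τ (var n)    = refl
ren-tsub ρ τ (lam M)    = cong lam (ren-tsub (ext ρ) τ M)
ren-tsub ρ τ (app M N)  = cong₂ app (ren-tsub ρ τ M) (ren-tsub ρ τ N)
ren-tsub ρ τ (Lam M)    = cong Lam (ren-tsub ρ (extsT τ) M)
ren-tsub ρ τ (tapp M A) = cong (λ X → tapp X (tsubT τ A)) (ren-tsub ρ τ M)
ren-tsub ρ τ star       = refl
ren-tsub ρ τ (tri M N)  = cong₂ tri (ren-tsub ρ τ M) (ren-tsub ρ τ N)
ren-tsub ρ τ (gen A)    = refl
ren-tsub ρ τ (ver A M)  = cong (ver (tsubT τ A)) (ren-tsub ρ τ M)
ren-tsub ρ τ (nu M)     = cong nu (ren-tsub ρ (erenT suc ∘ τ) M)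

ren-eren : ∀ ρ ρ′ M → ren ρ (eren ρ′ M) ≡ eren ρ′ (ren ρ M)
ren-eren ρ ρ′ (var n)    = refl
ren-eren ρ ρ′ (lam M)    = cong lam (ren-eren (ext ρ) ρ′ M)
ren-eren ρ ρ′ (app M N)  = cong₂ app (ren-eren ρ ρ′ M) (ren-eren ρ ρ′ N)
ren-eren ρ ρ′ (Lam M)    = cong Lam (ren-eren ρ ρ′ M)
ren-eren ρ ρ′ (tapp M A) = cong (λ X → tapp X (erenT ρ′ A)) (ren-eren ρ ρ′ M)
ren-eren ρ ρ′ star       = refl
ren-eren ρ ρ′ (tri M N)  = cong₂ tri (ren-eren ρ ρ′ M) (ren-eren ρ ρ′ N)
ren-eren ρ ρ′ (gen A)    = refl
ren-eren ρ ρ′ (ver A M)  = cong (ver (erenT ρ′ A)) (ren-eren ρ ρ′ M)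
ren-eren ρ ρ′ (nu M)     = cong nu (ren-eren ρ (ext ρ′) M)

ren-tren : ∀ ρ ρ′ M → ren ρ (tren ρ′ M) ≡ tren ρ′ (ren ρ M)
ren-tren ρ ρ′ M = begin
  ren ρ (tren ρ′ M)          ≡⟨ cong (ren ρ) (tren-as-tsub ρ′ M) ⟩
  ren ρ (tsub (tv ∘ ρ′) M)   ≡⟨ ren-tsub ρ (tv ∘ ρ′) M ⟩
  tsub (tv ∘ ρ′) (ren ρ M)   ≡⟨ tren-as-tsub ρ′ (ren ρ M) ⟨
  tren ρ′ (ren ρ M)          ∎

exts-ren : ∀ ρ σ → ren (ext ρ) ∘ exts σ ≗ exts (ren ρ ∘ σ)
exts-ren ρ σ zero    = refl
exts-ren ρ σ (suc n) = trans (ren-ren (ext ρ) suc (σ n)) (sym (ren-ren suc ρ (σ n)))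

ren-sub : ∀ ρ σ M → ren ρ (sub σ M) ≡ sub (ren ρ ∘ σ) M
ren-sub ρ σ (var n)    = refl
ren-sub ρ σ (lam M)    = cong lam (trans (ren-sub (ext ρ) (exts σ) M) (sub-cong (exts-ren ρ σ) M))
ren-sub ρ σ (app M N)  = cong₂ app (ren-sub ρ σ M) (ren-sub ρ σ N)
ren-sub ρ σ (Lam M)    =
  cong Lam (trans (ren-sub ρ (tren suc ∘ σ) M) (sub-cong (ren-tren ρ suc ∘ σ) M))
ren-sub ρ σ (tapp M A) = cong (λ X → tapp X A) (ren-sub ρ σ M)
ren-sub ρ σ star       = refl
ren-sub ρ σ (tri M N)  = cong₂ tri (ren-sub ρ σ M) (ren-sub ρ σ N)
ren-sub ρ σ (gen A)    = refl
ren-sub ρ σ (ver A M)  = cong (ver A) (ren-sub ρ σ M)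
ren-sub ρ σ (nu M)     =
  cong nu (trans (ren-sub ρ (eren suc ∘ σ) M) (sub-cong (ren-eren ρ suc ∘ σ) M))

tsub-sub : ∀ τ σ M → tsub τ (sub σ M) ≡ sub (tsub τ ∘ σ) (tsub τ M)
tsub-sub τ σ (var n)    = refl
tsub-sub τ σ (lam M)    = cong lam (trans (tsub-sub τ (exts σ) M)
  (sub-cong (λ { zero → refl ; (suc n) → sym (ren-tsub suc τ (σ n)) }) (tsub τ M)))
tsub-sub τ σ (app M N)  = cong₂ app (tsub-sub τ σ M) (tsub-sub τ σ N)
tsub-sub τ σ (Lam M)    = cong Lam (trans (tsub-sub (extsT τ) (tren suc ∘ σ) M)
  (sub-cong (tsub-extsT-tren τ ∘ σ) (tsub (extsT τ) M)))
tsub-sub τ σ (tapp M A) = cong (λ X → tapp X (tsubT τ A)) (tsub-sub τ σ M)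
tsub-sub τ σ star       = refl
tsub-sub τ σ (tri M N)  = cong₂ tri (tsub-sub τ σ M) (tsub-sub τ σ N)
tsub-sub τ σ (gen A)    = refl
tsub-sub τ σ (ver A M)  = cong (ver (tsubT τ A)) (tsub-sub τ σ M)
tsub-sub τ σ (nu M)     = cong nu (trans (tsub-sub (erenT suc ∘ τ) (eren suc ∘ σ) M)
  (sub-cong (λ n → sym (eren-tsub suc τ (σ n))) (tsub (erenT suc ∘ τ) M)))

eren-tren : ∀ ρ ρ′ M → eren ρ (tren ρ′ M) ≡ tren ρ′ (eren ρ M)
eren-tren ρ ρ′ M = begin
  eren ρ (tren ρ′ M)                     ≡⟨ cong (eren ρ) (tren-as-tsub ρ′ M) ⟩
  eren ρ (tsub (tv ∘ ρ′) M)              ≡⟨ eren-tsub ρ (tv ∘ ρ′) M ⟩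
  tsub (tv ∘ ρ′) (eren ρ M)              ≡⟨ tren-as-tsub ρ′ (eren ρ M) ⟨
  tren ρ′ (eren ρ M)                     ∎

eren-sub : ∀ ρ σ M → eren ρ (sub σ M) ≡ sub (eren ρ ∘ σ) (eren ρ M)
eren-sub ρ σ (var n)    = refl
eren-sub ρ σ (lam M)    = cong lam (trans (eren-sub ρ (exts σ) M)
  (sub-cong (λ { zero → refl ; (suc n) → sym (ren-eren suc ρ (σ n)) }) (eren ρ M)))
eren-sub ρ σ (app M N)  = cong₂ app (eren-sub ρ σ M) (eren-sub ρ σ N)
eren-sub ρ σ (Lam M)    = cong Lam (trans (eren-sub ρ (tren suc ∘ σ) M)
  (sub-cong (eren-tren ρ suc ∘ σ) (eren ρ M)))
eren-sub ρ σ (tapp M A) = cong (λ X → tapp X (erenT ρ A)) (eren-sub ρ σ M)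
eren-sub ρ σ star       = refl
eren-sub ρ σ (tri M N)  = cong₂ tri (eren-sub ρ σ M) (eren-sub ρ σ N)
eren-sub ρ σ (gen A)    = refl
eren-sub ρ σ (ver A M)  = cong (ver (erenT ρ A)) (eren-sub ρ σ M)
eren-sub ρ σ (nu M)     = cong nu (trans (eren-sub (ext ρ) (eren suc ∘ σ) M)
  (sub-cong (eren-ext-suc ρ ∘ σ) (eren (ext ρ) M)))

tren-sub : ∀ ρ σ M → tren ρ (sub σ M) ≡ sub (tren ρ ∘ σ) (tren ρ M)
tren-sub ρ σ M = begin
  tren ρ (sub σ M)                               ≡⟨ tren-as-tsub ρ (sub σ M) ⟩
  tsub (tv ∘ ρ) (sub σ M)                        ≡⟨ tsub-sub (tv ∘ ρ) σ M ⟩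
  sub (tsub (tv ∘ ρ) ∘ σ) (tsub (tv ∘ ρ) M)      ≡⟨ sub-cong (sym ∘ tren-as-tsub ρ ∘ σ) (tsub (tv ∘ ρ) M) ⟩
  sub (tren ρ ∘ σ) (tsub (tv ∘ ρ) M)             ≡⟨ cong (sub (tren ρ ∘ σ)) (tren-as-tsub ρ M) ⟨
  sub (tren ρ ∘ σ) (tren ρ M)                    ∎

exts-sub : ∀ σ τ → sub (exts σ) ∘ exts τ ≗ exts (sub σ ∘ τ)
exts-sub σ τ zero    = refl
exts-sub σ τ (suc n) = trans (sub-ren (exts σ) suc (τ n)) (sym (ren-sub suc σ (τ n)))

sub-sub : ∀ σ τ M → sub σ (sub τ M) ≡ sub (sub σ ∘ τ) M
sub-sub σ τ (var n)    = refl
sub-sub σ τ (lam M)    = cong lam (trans (sub-sub (exts σ) (exts τ) M) (sub-cong (exts-sub σ τ) M))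
sub-sub σ τ (app M N)  = cong₂ app (sub-sub σ τ M) (sub-sub σ τ N)
sub-sub σ τ (Lam M)    = cong Lam (trans (sub-sub (tren suc ∘ σ) (tren suc ∘ τ) M)
  (sub-cong (λ n → sym (tren-sub suc σ (τ n))) M))
sub-sub σ τ (tapp M A) = cong (λ X → tapp X A) (sub-sub σ τ M)
sub-sub σ τ star       = refl
sub-sub σ τ (tri M N)  = cong₂ tri (sub-sub σ τ M) (sub-sub σ τ N)
sub-sub σ τ (gen A)    = refl
sub-sub σ τ (ver A M)  = cong (ver A) (sub-sub σ τ M)
sub-sub σ τ (nu M)     = cong nu (trans (sub-sub (eren suc ∘ σ) (eren suc ∘ τ) M)
  (sub-cong (λ n → sym (eren-sub suc σ (τ n))) M))

exts-id : ∀ {σ} → σ ≗ var → exts σ ≗ var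
exts-id h zero    = refl
exts-id h (suc n) = cong (ren suc) (h n)

sub-id : ∀ {σ} → σ ≗ var → ∀ M → sub σ M ≡ M
sub-id h (var n)    = h n
sub-id h (lam M)    = cong lam (sub-id (exts-id h) M)
sub-id h (app M N)  = cong₂ app (sub-id h M) (sub-id h N)
sub-id h (Lam M)    = cong Lam (sub-id (cong (tren suc) ∘ h) M)
sub-id h (tapp M A) = cong (λ X → tapp X A) (sub-id h M)
sub-id h star       = refl
sub-id h (tri M N)  = cong₂ tri (sub-id h M) (sub-id h N)
sub-id h (gen A)    = refl
sub-id h (ver A M)  = cong (ver A) (sub-id h M)
sub-id h (nu M)     = cong nu (sub-id (cong (eren suc) ∘ h) M)

infixl 8 _[_] _[_]T

_[_] : Tm → Tm → Tm
M [ N ] = sub (N •_) M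

_[_]T : Tm → Ty → Tm
M [ A ]T = tsub (A •T_) M

ren-[] : ∀ ρ M N → ren ρ (M [ N ]) ≡ ren (ext ρ) M [ ren ρ N ]
ren-[] ρ M N = begin
  ren ρ (sub (N •_) M)               ≡⟨ ren-sub ρ (N •_) M ⟩
  sub (ren ρ ∘ (N •_)) M             ≡⟨ sub-cong (λ { zero → refl ; (suc n) → refl }) M ⟩
  sub ((ren ρ N •_) ∘ ext ρ) M       ≡⟨ sub-ren (ren ρ N •_) (ext ρ) M ⟨
  sub (ren ρ N •_) (ren (ext ρ) M)   ∎

tsub-[] : ∀ τ M N → tsub τ (M [ N ]) ≡ tsub τ M [ tsub τ N ]
tsub-[] τ M N =
  trans (tsub-sub τ (N •_) M) (sub-cong (λ { zero → refl ; (suc n) → refl }) (tsub τ M))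

eren-[] : ∀ ρ M N → eren ρ (M [ N ]) ≡ eren ρ M [ eren ρ N ]
eren-[] ρ M N =
  trans (eren-sub ρ (N •_) M) (sub-cong (λ { zero → refl ; (suc n) → refl }) (eren ρ M))

sub-[] : ∀ σ M N → sub σ (M [ N ]) ≡ sub (exts σ) M [ sub σ N ]
sub-[] σ M N = begin
  sub σ (sub (N •_) M)                 ≡⟨ sub-sub σ (N •_) M ⟩
  sub (sub σ ∘ (N •_)) M               ≡⟨ sub-cong pointwise M ⟩
  sub (sub (sub σ N •_) ∘ exts σ) M    ≡⟨ sub-sub (sub σ N •_) (exts σ) M ⟨
  sub (sub σ N •_) (sub (exts σ) M)    ∎
  where
  pointwise : sub σ ∘ (N •_) ≗ sub (sub σ N •_) ∘ exts σ
  pointwise zero    = refl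
  pointwise (suc n) = sym (trans (sub-ren (sub σ N •_) suc (σ n)) (sub-id (λ _ → refl) (σ n)))

tsub-[]T : ∀ τ M A → tsub τ (M [ A ]T) ≡ tsub (extsT τ) M [ tsubT τ A ]T
tsub-[]T τ M A = begin
  tsub τ (tsub (A •T_) M)                     ≡⟨ tsub-tsub τ (A •T_) M ⟩
  tsub (tsubT τ ∘ (A •T_)) M                  ≡⟨ tsub-cong pointwise M ⟩
  tsub (tsubT (tsubT τ A •T_) ∘ extsT τ) M    ≡⟨ tsub-tsub (tsubT τ A •T_) (extsT τ) M ⟨
  tsub (tsubT τ A •T_) (tsub (extsT τ) M)     ∎
  where
  pointwise : tsubT τ ∘ (A •T_) ≗ tsubT (tsubT τ A •T_) ∘ extsT τ
  pointwise zero    = refl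
  pointwise (suc n) = sym (tsubT-•T-trenT (tsubT τ A) (τ n))

eren-[]T : ∀ ρ M A → eren ρ (M [ A ]T) ≡ eren ρ M [ erenT ρ A ]T
eren-[]T ρ M A =
  trans (eren-tsub ρ (A •T_) M) (tsub-cong (λ { zero → refl ; (suc n) → refl }) (eren ρ M))

sub-[]T : ∀ σ M A → sub σ (M [ A ]T) ≡ sub (tren suc ∘ σ) M [ A ]T
sub-[]T σ M A = begin
  sub σ (tsub (A •T_) M)
    ≡⟨ sub-cong (sym ∘ tsub-•T-tren A ∘ σ) (tsub (A •T_) M) ⟩
  sub (tsub (A •T_) ∘ tren suc ∘ σ) (tsub (A •T_) M)
    ≡⟨ tsub-sub (A •T_) (tren suc ∘ σ) M ⟨
  tsub (A •T_) (sub (tren suc ∘ σ) M) ∎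

-- The contractum ν𝐚.ver_{A{a:=𝐚}}(M 𝐚) of ver_{∀a.A}(M).
νver : Ty → Tm → Tm
νver A M = nu (ver (instEv A) (tapp (eren suc M) (ev zero)))

ren-νver : ∀ ρ A M → ren ρ (νver A M) ≡ νver A (ren ρ M)
ren-νver ρ A M = cong (λ X → nu (ver (instEv A) (tapp X (ev zero)))) (ren-eren ρ suc M)

tsub-νver : ∀ τ A M → tsub τ (νver A M) ≡ νver (tsubT (extsT τ) A) (tsub τ M)
tsub-νver τ A M = cong₂ (λ B X → nu (ver B (tapp X (ev zero))))
  (tsubT-instEv τ A) (sym (eren-tsub suc τ M))

eren-νver : ∀ ρ A M → eren ρ (νver A M) ≡ νver (erenT ρ A) (eren ρ M)
eren-νver ρ A M = cong₂ (λ B X → nu (ver B (tapp X (ev zero))))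
  (erenT-instEv ρ A) (eren-ext-suc ρ M)

sub-νver : ∀ σ A M → sub σ (νver A M) ≡ νver A (sub σ M)
sub-νver σ A M = cong (λ X → nu (ver (instEv A) (tapp X (ev zero)))) (sym (eren-sub suc σ M))

-- Parallel reduction

infix 4 _⇛_ _⇛ˢ_

-- The side condition of pνgc is an equation rather than the target index
-- eren suc N, so that derivations can still be inverted by pattern matching.
data _⇛_ : Tm → Tm → Set where
  pvar   : ∀ {n} → var n ⇛ var n
  plam   : ∀ {M M′} → M ⇛ M′ → lam M ⇛ lam M′
  papp   : ∀ {M M′ N N′} → M ⇛ M′ → N ⇛ N′ → app M N ⇛ app M′ N′
  pLam   : ∀ {M M′} → M ⇛ M′ → Lam M ⇛ Lam M′
  ptapp  : ∀ {M M′ A} → M ⇛ M′ → tapp M A ⇛ tapp M′ A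
  pstar  : star ⇛ star
  ptri   : ∀ {M M′ N N′} → M ⇛ M′ → N ⇛ N′ → tri M N ⇛ tri M′ N′
  pgen   : ∀ {A} → gen A ⇛ gen A
  pver   : ∀ {A M M′} → M ⇛ M′ → ver A M ⇛ ver A M′
  pnu    : ∀ {M M′} → M ⇛ M′ → nu M ⇛ nu M′
  pβ     : ∀ {M M′ N N′} → M ⇛ M′ → N ⇛ N′ → app (lam M) N ⇛ M′ [ N′ ]
  pβT    : ∀ {M M′ A} → M ⇛ M′ → tapp (Lam M) A ⇛ M′ [ A ]T
  p▷⋆    : ∀ {M M′} → M ⇛ M′ → tri star M ⇛ M′
  pverEv : ∀ {i} → ver (ev i) (gen (ev i)) ⇛ star
  pgen⇒  : ∀ {A B} → gen (A ⇒ B) ⇛ lam (tri (ver A (var zero)) (gen B))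
  pver⇒  : ∀ {A B M M′} → M ⇛ M′ → ver (A ⇒ B) M ⇛ ver B (app M′ (gen A))
  pgen∀  : ∀ {A} → gen (all A) ⇛ Lam (gen A)
  pver∀  : ∀ {A M M′} → M ⇛ M′ → ver (all A) M ⇛ νver A M′
  pνgc   : ∀ {M M′ N} → M ⇛ M′ → M′ ≡ eren suc N → nu M ⇛ N

⇛-target : ∀ {M N N′} → N ≡ N′ → M ⇛ N′ → M ⇛ N
⇛-target refl d = d

⇛-refl : ∀ M → M ⇛ M
⇛-refl (var n)    = pvar
⇛-refl (lam M)    = plam (⇛-refl M)
⇛-refl (app M N)  = papp (⇛-refl M) (⇛-refl N)
⇛-refl (Lam M)    = pLam (⇛-refl M)
⇛-refl (tapp M A) = ptapp (⇛-refl M)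
⇛-refl star       = pstar
⇛-refl (tri M N)  = ptri (⇛-refl M) (⇛-refl N)
⇛-refl (gen A)    = pgen
⇛-refl (ver A M)  = pver (⇛-refl M)
⇛-refl (nu M)     = pnu (⇛-refl M)

⇛-ren : ∀ ρ {M N} → M ⇛ N → ren ρ M ⇛ ren ρ N
⇛-ren ρ pvar       = pvar
⇛-ren ρ (plam d)   = plam (⇛-ren (ext ρ) d)
⇛-ren ρ (papp d e) = papp (⇛-ren ρ d) (⇛-ren ρ e)
⇛-ren ρ (pLam d)   = pLam (⇛-ren ρ d)
⇛-ren ρ (ptapp d)  = ptapp (⇛-ren ρ d)
⇛-ren ρ pstar      = pstar
⇛-ren ρ (ptri d e) = ptri (⇛-ren ρ d) (⇛-ren ρ e)
⇛-ren ρ pgen       = pgen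
⇛-ren ρ (pver d)   = pver (⇛-ren ρ d)
⇛-ren ρ (pnu d)    = pnu (⇛-ren ρ d)
⇛-ren ρ (pβ {M′ = M′} {N′ = N′} d e) =
  ⇛-target (ren-[] ρ M′ N′) (pβ (⇛-ren (ext ρ) d) (⇛-ren ρ e))
⇛-ren ρ (pβT {M′ = M′} {A} d) = ⇛-target (ren-tsub ρ (A •T_) M′) (pβT (⇛-ren ρ d))
⇛-ren ρ (p▷⋆ d)    = p▷⋆ (⇛-ren ρ d)
⇛-ren ρ pverEv     = pverEv
⇛-ren ρ pgen⇒      = pgen⇒
⇛-ren ρ (pver⇒ d)  = pver⇒ (⇛-ren ρ d)
⇛-ren ρ pgen∀      = pgen∀
⇛-ren ρ (pver∀ {A} {M′ = M′} d) = ⇛-target (ren-νver ρ A M′) (pver∀ (⇛-ren ρ d))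
⇛-ren ρ (pνgc {N = N} d refl) = pνgc (⇛-ren ρ d) (ren-eren ρ suc N)

⇛-tsub : ∀ τ {M N} → M ⇛ N → tsub τ M ⇛ tsub τ N
⇛-tsub τ pvar       = pvar
⇛-tsub τ (plam d)   = plam (⇛-tsub τ d)
⇛-tsub τ (papp d e) = papp (⇛-tsub τ d) (⇛-tsub τ e)
⇛-tsub τ (pLam d)   = pLam (⇛-tsub (extsT τ) d)
⇛-tsub τ (ptapp d)  = ptapp (⇛-tsub τ d)
⇛-tsub τ pstar      = pstar
⇛-tsub τ (ptri d e) = ptri (⇛-tsub τ d) (⇛-tsub τ e)
⇛-tsub τ pgen       = pgen
⇛-tsub τ (pver d)   = pver (⇛-tsub τ d)
⇛-tsub τ (pnu d)    = pnu (⇛-tsub (erenT suc ∘ τ) d)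
⇛-tsub τ (pβ {M′ = M′} {N′ = N′} d e) =
  ⇛-target (tsub-[] τ M′ N′) (pβ (⇛-tsub τ d) (⇛-tsub τ e))
⇛-tsub τ (pβT {M′ = M′} {A} d) = ⇛-target (tsub-[]T τ M′ A) (pβT (⇛-tsub (extsT τ) d))
⇛-tsub τ (p▷⋆ d)    = p▷⋆ (⇛-tsub τ d)
⇛-tsub τ pverEv     = pverEv
⇛-tsub τ pgen⇒      = pgen⇒
⇛-tsub τ (pver⇒ d)  = pver⇒ (⇛-tsub τ d)
⇛-tsub τ pgen∀      = pgen∀
⇛-tsub τ (pver∀ {A} {M′ = M′} d) = ⇛-target (tsub-νver τ A M′) (pver∀ (⇛-tsub τ d))
⇛-tsub τ (pνgc {N = N} d refl) = pνgc (⇛-tsub (erenT suc ∘ τ) d) (sym (eren-tsub suc τ N))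

⇛-tren : ∀ ρ {M N} → M ⇛ N → tren ρ M ⇛ tren ρ N
⇛-tren ρ {M} {N} d rewrite tren-as-tsub ρ M | tren-as-tsub ρ N = ⇛-tsub (tv ∘ ρ) d

⇛-eren : ∀ ρ {M N} → M ⇛ N → eren ρ M ⇛ eren ρ N
⇛-eren ρ pvar       = pvar
⇛-eren ρ (plam d)   = plam (⇛-eren ρ d)
⇛-eren ρ (papp d e) = papp (⇛-eren ρ d) (⇛-eren ρ e)
⇛-eren ρ (pLam d)   = pLam (⇛-eren ρ d)
⇛-eren ρ (ptapp d)  = ptapp (⇛-eren ρ d)
⇛-eren ρ pstar      = pstar
⇛-eren ρ (ptri d e) = ptri (⇛-eren ρ d) (⇛-eren ρ e)
⇛-eren ρ pgen       = pgen
⇛-eren ρ (pver d)   = pver (⇛-eren ρ d)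
⇛-eren ρ (pnu d)    = pnu (⇛-eren (ext ρ) d)
⇛-eren ρ (pβ {M′ = M′} {N′ = N′} d e) =
  ⇛-target (eren-[] ρ M′ N′) (pβ (⇛-eren ρ d) (⇛-eren ρ e))
⇛-eren ρ (pβT {M′ = M′} {A} d) = ⇛-target (eren-[]T ρ M′ A) (pβT (⇛-eren ρ d))
⇛-eren ρ (p▷⋆ d)    = p▷⋆ (⇛-eren ρ d)
⇛-eren ρ pverEv     = pverEv
⇛-eren ρ pgen⇒      = pgen⇒
⇛-eren ρ (pver⇒ d)  = pver⇒ (⇛-eren ρ d)
⇛-eren ρ pgen∀      = pgen∀
⇛-eren ρ (pver∀ {A} {M′ = M′} d) = ⇛-target (eren-νver ρ A M′) (pver∀ (⇛-eren ρ d))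
⇛-eren ρ (pνgc {N = N} d refl) = pνgc (⇛-eren (ext ρ) d) (eren-ext-suc ρ N)

_⇛ˢ_ : (ℕ → Tm) → (ℕ → Tm) → Set
σ ⇛ˢ σ′ = ∀ n → σ n ⇛ σ′ n

⇛ˢ-exts : ∀ {σ σ′} → σ ⇛ˢ σ′ → exts σ ⇛ˢ exts σ′
⇛ˢ-exts h zero    = pvar
⇛ˢ-exts h (suc n) = ⇛-ren suc (h n)

⇛ˢ-• : ∀ {N N′} → N ⇛ N′ → (N •_) ⇛ˢ (N′ •_)
⇛ˢ-• d zero    = d
⇛ˢ-• d (suc n) = pvar

⇛-sub : ∀ {σ σ′} → σ ⇛ˢ σ′ → ∀ {M N} → M ⇛ N → sub σ M ⇛ sub σ′ N
⇛-sub h (pvar {n})  = h n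
⇛-sub h (plam d)    = plam (⇛-sub (⇛ˢ-exts h) d)
⇛-sub h (papp d e)  = papp (⇛-sub h d) (⇛-sub h e)
⇛-sub h (pLam d)    = pLam (⇛-sub (⇛-tren suc ∘ h) d)
⇛-sub h (ptapp d)   = ptapp (⇛-sub h d)
⇛-sub h pstar       = pstar
⇛-sub h (ptri d e)  = ptri (⇛-sub h d) (⇛-sub h e)
⇛-sub h pgen        = pgen
⇛-sub h (pver d)    = pver (⇛-sub h d)
⇛-sub h (pnu d)     = pnu (⇛-sub (⇛-eren suc ∘ h) d)
⇛-sub {σ′ = σ′} h (pβ {M′ = M′} {N′ = N′} d e) =
  ⇛-target (sub-[] σ′ M′ N′) (pβ (⇛-sub (⇛ˢ-exts h) d) (⇛-sub h e))
⇛-sub {σ′ = σ′} h (pβT {M′ = M′} {A} d) =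
  ⇛-target (sub-[]T σ′ M′ A) (pβT (⇛-sub (⇛-tren suc ∘ h) d))
⇛-sub h (p▷⋆ d)     = p▷⋆ (⇛-sub h d)
⇛-sub h pverEv      = pverEv
⇛-sub h pgen⇒       = pgen⇒
⇛-sub h (pver⇒ d)   = pver⇒ (⇛-sub h d)
⇛-sub h pgen∀       = pgen∀
⇛-sub {σ′ = σ′} h (pver∀ {A} {M′ = M′} d) = ⇛-target (sub-νver σ′ A M′) (pver∀ (⇛-sub h d))
⇛-sub {σ′ = σ′} h (pνgc {N = N} d refl) =
  pνgc (⇛-sub (⇛-eren suc ∘ h) d) (sym (eren-sub suc σ′ N))

⇛-[] : ∀ {M M′ N N′} → M ⇛ M′ → N ⇛ N′ → M [ N ] ⇛ M′ [ N′ ]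
⇛-[] d e = ⇛-sub (⇛ˢ-• e) d

⇛-[]T : ∀ {M M′} A → M ⇛ M′ → M [ A ]T ⇛ M′ [ A ]T
⇛-[]T A = ⇛-tsub (A •T_)

⇛-νver : ∀ A {M M′} → M ⇛ M′ → νver A M ⇛ νver A M′
⇛-νver A d = pnu (pver (ptapp (⇛-eren suc d)))

-- Free eigenvariables

↑ : (ℕ → Set) → ℕ → Set
↑ P zero    = ⊤
↑ P (suc n) = P n

AllEvT : (ℕ → Set) → Ty → Set
AllEvT P (tv n)  = ⊤
AllEvT P (ev n)  = P n
AllEvT P (A ⇒ B) = AllEvT P A × AllEvT P B
AllEvT P (all A) = AllEvT P A

AllEv : (ℕ → Set) → Tm → Set
AllEv P (var n)    = ⊤
AllEv P (lam M)    = AllEv P M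
AllEv P (app M N)  = AllEv P M × AllEv P N
AllEv P (Lam M)    = AllEv P M
AllEv P (tapp M A) = AllEv P M × AllEvT P A
AllEv P star       = ⊤
AllEv P (tri M N)  = AllEv P M × AllEv P N
AllEv P (gen A)    = AllEvT P A
AllEv P (ver A M)  = AllEvT P A × AllEv P M
AllEv P (nu M)     = AllEv (↑ P) M

↑-universal : ∀ {P} → (∀ n → P n) → ∀ n → ↑ P n
↑-universal h zero    = tt
↑-universal h (suc n) = h n

AllEvT-universal : ∀ {P} → (∀ n → P n) → ∀ A → AllEvT P A
AllEvT-universal h (tv n)  = tt
AllEvT-universal h (ev n)  = h n
AllEvT-universal h (A ⇒ B) = AllEvT-universal h A , AllEvT-universal h B
AllEvT-universal h (all A) = AllEvT-universal h A

AllEv-universal : ∀ {P} → (∀ n → P n) → ∀ M → AllEv P M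
AllEv-universal h (var n)    = tt
AllEv-universal h (lam M)    = AllEv-universal h M
AllEv-universal h (app M N)  = AllEv-universal h M , AllEv-universal h N
AllEv-universal h (Lam M)    = AllEv-universal h M
AllEv-universal h (tapp M A) = AllEv-universal h M , AllEvT-universal h A
AllEv-universal h star       = tt
AllEv-universal h (tri M N)  = AllEv-universal h M , AllEv-universal h N
AllEv-universal h (gen A)    = AllEvT-universal h A
AllEv-universal h (ver A M)  = AllEvT-universal h A , AllEv-universal h M
AllEv-universal h (nu M)     = AllEv-universal (↑-universal h) M

↑-ext : ∀ {P Q ρ} → (∀ n → P n → Q (ρ n)) → ∀ n → ↑ P n → ↑ Q (ext ρ n)
↑-ext h zero    _ = tt
↑-ext h (suc n) p = h n p

AllEvT-erenT : ∀ {P Q ρ} → (∀ n → P n → Q (ρ n)) → ∀ A → AllEvT P A → AllEvT Q (erenT ρ A)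
AllEvT-erenT h (tv n)  a       = tt
AllEvT-erenT h (ev n)  a       = h n a
AllEvT-erenT h (A ⇒ B) (a , b) = AllEvT-erenT h A a , AllEvT-erenT h B b
AllEvT-erenT h (all A) a       = AllEvT-erenT h A a

AllEv-eren : ∀ {P Q ρ} → (∀ n → P n → Q (ρ n)) → ∀ M → AllEv P M → AllEv Q (eren ρ M)
AllEv-eren h (var n)    a       = tt
AllEv-eren h (lam M)    a       = AllEv-eren h M a
AllEv-eren h (app M N)  (a , b) = AllEv-eren h M a , AllEv-eren h N b
AllEv-eren h (Lam M)    a       = AllEv-eren h M a
AllEv-eren h (tapp M A) (a , b) = AllEv-eren h M a , AllEvT-erenT h A b
AllEv-eren h star       a       = tt
AllEv-eren h (tri M N)  (a , b) = AllEv-eren h M a , AllEv-eren h N b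
AllEv-eren h (gen A)    a       = AllEvT-erenT h A a
AllEv-eren h (ver A M)  (a , b) = AllEvT-erenT h A a , AllEv-eren h M b
AllEv-eren h (nu M)     a       = AllEv-eren (↑-ext h) M a

↑-ext⁻ : ∀ {P Q ρ} → (∀ n → Q (ρ n) → P n) → ∀ n → ↑ Q (ext ρ n) → ↑ P n
↑-ext⁻ h zero    _ = tt
↑-ext⁻ h (suc n) p = h n p

AllEvT-erenT⁻ : ∀ {P Q ρ} → (∀ n → Q (ρ n) → P n) → ∀ A → AllEvT Q (erenT ρ A) → AllEvT P A
AllEvT-erenT⁻ h (tv n)  a       = tt
AllEvT-erenT⁻ h (ev n)  a       = h n a
AllEvT-erenT⁻ h (A ⇒ B) (a , b) = AllEvT-erenT⁻ h A a , AllEvT-erenT⁻ h B b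
AllEvT-erenT⁻ h (all A) a       = AllEvT-erenT⁻ h A a

AllEv-eren⁻ : ∀ {P Q ρ} → (∀ n → Q (ρ n) → P n) → ∀ M → AllEv Q (eren ρ M) → AllEv P M
AllEv-eren⁻ h (var n)    a       = tt
AllEv-eren⁻ h (lam M)    a       = AllEv-eren⁻ h M a
AllEv-eren⁻ h (app M N)  (a , b) = AllEv-eren⁻ h M a , AllEv-eren⁻ h N b
AllEv-eren⁻ h (Lam M)    a       = AllEv-eren⁻ h M a
AllEv-eren⁻ h (tapp M A) (a , b) = AllEv-eren⁻ h M a , AllEvT-erenT⁻ h A b
AllEv-eren⁻ h star       a       = tt
AllEv-eren⁻ h (tri M N)  (a , b) = AllEv-eren⁻ h M a , AllEv-eren⁻ h N b
AllEv-eren⁻ h (gen A)    a       = AllEvT-erenT⁻ h A a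
AllEv-eren⁻ h (ver A M)  (a , b) = AllEvT-erenT⁻ h A a , AllEv-eren⁻ h M b
AllEv-eren⁻ h (nu M)     a       = AllEv-eren⁻ (↑-ext⁻ h) M a

AllEvT-trenT : ∀ {P} ρ A → AllEvT P A → AllEvT P (trenT ρ A)
AllEvT-trenT ρ (tv n)  a       = tt
AllEvT-trenT ρ (ev n)  a       = a
AllEvT-trenT ρ (A ⇒ B) (a , b) = AllEvT-trenT ρ A a , AllEvT-trenT ρ B b
AllEvT-trenT ρ (all A) a       = AllEvT-trenT (ext ρ) A a

AllEvT-extsT : ∀ {P σ} → (∀ n → AllEvT P (σ n)) → ∀ n → AllEvT P (extsT σ n)
AllEvT-extsT h zero    = tt
AllEvT-extsT {σ = σ} h (suc n) = AllEvT-trenT suc (σ n) (h n)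

AllEvT-tsubT : ∀ {P σ} → (∀ n → AllEvT P (σ n)) → ∀ A → AllEvT P A → AllEvT P (tsubT σ A)
AllEvT-tsubT h (tv n)  a       = h n
AllEvT-tsubT h (ev n)  a       = a
AllEvT-tsubT h (A ⇒ B) (a , b) = AllEvT-tsubT h A a , AllEvT-tsubT h B b
AllEvT-tsubT h (all A) a       = AllEvT-tsubT (AllEvT-extsT h) A a

AllEvT-instEv : ∀ {P} A → AllEvT P A → AllEvT (↑ P) (instEv A)
AllEvT-instEv A a =
  AllEvT-tsubT (λ { zero → tt ; (suc n) → tt }) (erenT suc A) (AllEvT-erenT (λ _ p → p) A a)

AllEv-ren : ∀ {P} ρ M → AllEv P M → AllEv P (ren ρ M)
AllEv-ren ρ (var n)    a       = tt
AllEv-ren ρ (lam M)    a       = AllEv-ren (ext ρ) M a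
AllEv-ren ρ (app M N)  (a , b) = AllEv-ren ρ M a , AllEv-ren ρ N b
AllEv-ren ρ (Lam M)    a       = AllEv-ren ρ M a
AllEv-ren ρ (tapp M A) (a , b) = AllEv-ren ρ M a , b
AllEv-ren ρ star       a       = tt
AllEv-ren ρ (tri M N)  (a , b) = AllEv-ren ρ M a , AllEv-ren ρ N b
AllEv-ren ρ (gen A)    a       = a
AllEv-ren ρ (ver A M)  (a , b) = a , AllEv-ren ρ M b
AllEv-ren ρ (nu M)     a       = AllEv-ren ρ M a

AllEv-tsub : ∀ {P τ} → (∀ n → AllEvT P (τ n)) → ∀ M → AllEv P M → AllEv P (tsub τ M)
AllEv-tsub h (var n)    a       = tt
AllEv-tsub h (lam M)    a       = AllEv-tsub h M a
AllEv-tsub h (app M N)  (a , b) = AllEv-tsub h M a , AllEv-tsub h N b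
AllEv-tsub h (Lam M)    a       = AllEv-tsub (AllEvT-extsT h) M a
AllEv-tsub h (tapp M A) (a , b) = AllEv-tsub h M a , AllEvT-tsubT h A b
AllEv-tsub h star       a       = tt
AllEv-tsub h (tri M N)  (a , b) = AllEv-tsub h M a , AllEv-tsub h N b
AllEv-tsub h (gen A)    a       = AllEvT-tsubT h A a
AllEv-tsub h (ver A M)  (a , b) = AllEvT-tsubT h A a , AllEv-tsub h M b
AllEv-tsub {τ = τ} h (nu M) a  = AllEv-tsub (λ n → AllEvT-erenT (λ _ p → p) (τ n) (h n)) M a

AllEv-tren : ∀ {P} ρ M → AllEv P M → AllEv P (tren ρ M)
AllEv-tren ρ M a rewrite tren-as-tsub ρ M = AllEv-tsub (λ _ → tt) M a

AllEv-sub : ∀ {P σ} → (∀ n → AllEv P (σ n)) → ∀ M → AllEv P M → AllEv P (sub σ M)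
AllEv-sub h (var n)    a       = h n
AllEv-sub {σ = σ} h (lam M) a   = AllEv-sub (λ { zero → tt ; (suc n) → AllEv-ren suc (σ n) (h n) }) M a
AllEv-sub h (app M N)  (a , b) = AllEv-sub h M a , AllEv-sub h N b
AllEv-sub {σ = σ} h (Lam M) a   = AllEv-sub (λ n → AllEv-tren suc (σ n) (h n)) M a
AllEv-sub h (tapp M A) (a , b) = AllEv-sub h M a , b
AllEv-sub h star       a       = tt
AllEv-sub h (tri M N)  (a , b) = AllEv-sub h M a , AllEv-sub h N b
AllEv-sub h (gen A)    a       = a
AllEv-sub h (ver A M)  (a , b) = a , AllEv-sub h M b
AllEv-sub {σ = σ} h (nu M) a    = AllEv-sub (λ n → AllEv-eren (λ _ p → p) (σ n) (h n)) M a

AllEv-⇛ : ∀ {P M N} → AllEv P M → M ⇛ N → AllEv P N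
AllEv-⇛ a       pvar       = tt
AllEv-⇛ a       (plam d)   = AllEv-⇛ a d
AllEv-⇛ (a , b) (papp d e) = AllEv-⇛ a d , AllEv-⇛ b e
AllEv-⇛ a       (pLam d)   = AllEv-⇛ a d
AllEv-⇛ (a , b) (ptapp d)  = AllEv-⇛ a d , b
AllEv-⇛ a       pstar      = tt
AllEv-⇛ (a , b) (ptri d e) = AllEv-⇛ a d , AllEv-⇛ b e
AllEv-⇛ a       pgen       = a
AllEv-⇛ (a , b) (pver d)   = a , AllEv-⇛ b d
AllEv-⇛ a       (pnu d)    = AllEv-⇛ a d
AllEv-⇛ (a , b) (pβ {M′ = M′} d e) =
  AllEv-sub (λ { zero → AllEv-⇛ b e ; (suc n) → tt }) M′ (AllEv-⇛ a d)
AllEv-⇛ (a , b) (pβT {M′ = M′} d) =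
  AllEv-tsub (λ { zero → b ; (suc n) → tt }) M′ (AllEv-⇛ a d)
AllEv-⇛ (_ , b) (p▷⋆ d)    = AllEv-⇛ b d
AllEv-⇛ a       pverEv     = tt
AllEv-⇛ (a , b) pgen⇒      = (a , tt) , b
AllEv-⇛ ((a , b) , c) (pver⇒ d) = b , AllEv-⇛ c d , a
AllEv-⇛ a       pgen∀      = a
AllEv-⇛ (a , b) (pver∀ {A} {M′ = M′} d) =
  AllEvT-instEv A a , AllEv-eren (λ _ p → p) M′ (AllEv-⇛ b d) , tt
AllEv-⇛ a       (pνgc {N = N} d refl) = AllEv-eren⁻ (λ _ p → p) N (AllEv-⇛ a d)

↑-ext-fixes : ∀ {P ρ} → (∀ n → P n → ρ n ≡ n) → ∀ n → ↑ P n → ext ρ n ≡ n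
↑-ext-fixes h zero    _ = refl
↑-ext-fixes h (suc n) p = cong suc (h n p)

erenT-fixes : ∀ {P ρ} → (∀ n → P n → ρ n ≡ n) → ∀ A → AllEvT P A → erenT ρ A ≡ A
erenT-fixes h (tv n)  a       = refl
erenT-fixes h (ev n)  a       = cong ev (h n a)
erenT-fixes h (A ⇒ B) (a , b) = cong₂ _⇒_ (erenT-fixes h A a) (erenT-fixes h B b)
erenT-fixes h (all A) a       = cong all (erenT-fixes h A a)

eren-fixes : ∀ {P ρ} → (∀ n → P n → ρ n ≡ n) → ∀ M → AllEv P M → eren ρ M ≡ M
eren-fixes h (var n)    a       = refl
eren-fixes h (lam M)    a       = cong lam (eren-fixes h M a)
eren-fixes h (app M N)  (a , b) = cong₂ app (eren-fixes h M a) (eren-fixes h N b)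
eren-fixes h (Lam M)    a       = cong Lam (eren-fixes h M a)
eren-fixes h (tapp M A) (a , b) = cong₂ tapp (eren-fixes h M a) (erenT-fixes h A b)
eren-fixes h star       a       = refl
eren-fixes h (tri M N)  (a , b) = cong₂ tri (eren-fixes h M a) (eren-fixes h N b)
eren-fixes h (gen A)    a       = cong gen (erenT-fixes h A a)
eren-fixes h (ver A M)  (a , b) = cong₂ ver (erenT-fixes h A a) (eren-fixes h M b)
eren-fixes h (nu M)     a       = cong nu (eren-fixes (↑-ext-fixes h) M a)

-- pred 0 = 0, so eren pred inverts eren suc only on terms in which eigenvariable 0
-- is not free; ⇛ preserves that property.
⇛-shifted : ∀ {N P} → eren suc N ⇛ P → P ≡ eren suc (eren pred P)
⇛-shifted {N} {P} d = begin
  P                        ≡⟨ eren-fixes (λ n p → suc-pred n {{p}}) P (AllEv-⇛ shifted d) ⟨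
  eren (suc ∘ pred) P      ≡⟨ eren-eren suc pred P ⟨
  eren suc (eren pred P)   ∎
  where
  shifted : AllEv NonZero (eren suc N)
  shifted = AllEv-eren (λ _ _ → nonZero) N (AllEv-universal {P = λ _ → ⊤} (λ _ → tt) N)

⇛-unshift : ∀ {N P} → eren suc N ⇛ P → N ⇛ eren pred P
⇛-unshift {N} d = subst (_⇛ _) (trans (eren-eren pred suc N) (eren-id N)) (⇛-eren pred d)

-- The diamond property of parallel reduction

⇛-diamond : Diamond _⇛_
diamond-app  : ∀ {M N R₁ R₂} → app M N ⇛ R₁ → app M N ⇛ R₂ → Joinable _⇛_ R₁ R₂
diamond-tapp : ∀ {M A R₁ R₂} → tapp M A ⇛ R₁ → tapp M A ⇛ R₂ → Joinable _⇛_ R₁ R₂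
diamond-tri  : ∀ {M N R₁ R₂} → tri M N ⇛ R₁ → tri M N ⇛ R₂ → Joinable _⇛_ R₁ R₂
diamond-gen  : ∀ {A R₁ R₂} → gen A ⇛ R₁ → gen A ⇛ R₂ → Joinable _⇛_ R₁ R₂
diamond-ver  : ∀ {A M R₁ R₂} → ver A M ⇛ R₁ → ver A M ⇛ R₂ → Joinable _⇛_ R₁ R₂
diamond-nu   : ∀ {M R₁ R₂} → nu M ⇛ R₁ → nu M ⇛ R₂ → Joinable _⇛_ R₁ R₂

⇛-diamond {var n} pvar pvar = var n , pvar , pvar
⇛-diamond {lam M} (plam d) (plam e) =
  let P , a , b = ⇛-diamond d e in lam P , plam a , plam b
⇛-diamond {app M N}  = diamond-app
⇛-diamond {Lam M} (pLam d) (pLam e) =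
  let P , a , b = ⇛-diamond d e in Lam P , pLam a , pLam b
⇛-diamond {tapp M A} = diamond-tapp
⇛-diamond {star} pstar pstar = star , pstar , pstar
⇛-diamond {tri M N}  = diamond-tri
⇛-diamond {gen A}    = diamond-gen
⇛-diamond {ver A M}  = diamond-ver
⇛-diamond {nu M}     = diamond-nu

diamond-app (papp d₁ d₂) (papp e₁ e₂) =
  let P , a₁ , b₁ = ⇛-diamond d₁ e₁
      Q , a₂ , b₂ = ⇛-diamond d₂ e₂
  in app P Q , papp a₁ a₂ , papp b₁ b₂
diamond-app (papp (plam d₁) d₂) (pβ e₁ e₂) =
  let P , a₁ , b₁ = ⇛-diamond d₁ e₁
      Q , a₂ , b₂ = ⇛-diamond d₂ e₂
  in P [ Q ] , pβ a₁ a₂ , ⇛-[] b₁ b₂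
diamond-app (pβ d₁ d₂) (papp (plam e₁) e₂) =
  let P , a₁ , b₁ = ⇛-diamond d₁ e₁
      Q , a₂ , b₂ = ⇛-diamond d₂ e₂
  in P [ Q ] , ⇛-[] a₁ a₂ , pβ b₁ b₂
diamond-app (pβ d₁ d₂) (pβ e₁ e₂) =
  let P , a₁ , b₁ = ⇛-diamond d₁ e₁
      Q , a₂ , b₂ = ⇛-diamond d₂ e₂
  in P [ Q ] , ⇛-[] a₁ a₂ , ⇛-[] b₁ b₂

diamond-tapp {A = A} (ptapp d) (ptapp e) =
  let P , a , b = ⇛-diamond d e in tapp P A , ptapp a , ptapp b
diamond-tapp {A = A} (ptapp (pLam d)) (pβT e) =
  let P , a , b = ⇛-diamond d e in P [ A ]T , pβT a , ⇛-[]T A b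
diamond-tapp {A = A} (pβT d) (ptapp (pLam e)) =
  let P , a , b = ⇛-diamond d e in P [ A ]T , ⇛-[]T A a , pβT b
diamond-tapp {A = A} (pβT d) (pβT e) =
  let P , a , b = ⇛-diamond d e in P [ A ]T , ⇛-[]T A a , ⇛-[]T A b

diamond-tri (ptri d₁ d₂) (ptri e₁ e₂) =
  let P , a₁ , b₁ = ⇛-diamond d₁ e₁
      Q , a₂ , b₂ = ⇛-diamond d₂ e₂
  in tri P Q , ptri a₁ a₂ , ptri b₁ b₂
diamond-tri (ptri pstar d) (p▷⋆ e) = let P , a , b = ⇛-diamond d e in P , p▷⋆ a , b
diamond-tri (p▷⋆ d) (ptri pstar e) = let P , a , b = ⇛-diamond d e in P , a , p▷⋆ b
diamond-tri (p▷⋆ d) (p▷⋆ e)        = ⇛-diamond d e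

diamond-gen pgen  pgen  = _ , pgen , pgen
diamond-gen pgen  pgen⇒ = _ , pgen⇒ , ⇛-refl _
diamond-gen pgen⇒ pgen  = _ , ⇛-refl _ , pgen⇒
diamond-gen pgen⇒ pgen⇒ = _ , ⇛-refl _ , ⇛-refl _
diamond-gen pgen  pgen∀ = _ , pgen∀ , ⇛-refl _
diamond-gen pgen∀ pgen  = _ , ⇛-refl _ , pgen∀
diamond-gen pgen∀ pgen∀ = _ , ⇛-refl _ , ⇛-refl _

diamond-ver {A} (pver d) (pver e) =
  let P , a , b = ⇛-diamond d e in ver A P , pver a , pver b
diamond-ver (pver pgen) pverEv      = star , pverEv , pstar
diamond-ver pverEv      (pver pgen) = star , pstar , pverEv
diamond-ver pverEv      pverEv      = star , pstar , pstar
diamond-ver (pver d) (pver⇒ e) =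
  let P , a , b = ⇛-diamond d e in _ , pver⇒ a , pver (papp b pgen)
diamond-ver (pver⇒ d) (pver e) =
  let P , a , b = ⇛-diamond d e in _ , pver (papp a pgen) , pver⇒ b
diamond-ver (pver⇒ d) (pver⇒ e) =
  let P , a , b = ⇛-diamond d e in _ , pver (papp a pgen) , pver (papp b pgen)
diamond-ver {all A} (pver d) (pver∀ e) =
  let P , a , b = ⇛-diamond d e in νver A P , pver∀ a , ⇛-νver A b
diamond-ver {all A} (pver∀ d) (pver e) =
  let P , a , b = ⇛-diamond d e in νver A P , ⇛-νver A a , pver∀ b
diamond-ver {all A} (pver∀ d) (pver∀ e) =
  let P , a , b = ⇛-diamond d e in νver A P , ⇛-νver A a , ⇛-νver A b

diamond-nu (pnu d) (pnu e) =
  let P , a , b = ⇛-diamond d e in nu P , pnu a , pnu b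
diamond-nu (pnu d) (pνgc e refl) =
  let P , a , b = ⇛-diamond d e in eren pred P , pνgc a (⇛-shifted b) , ⇛-unshift b
diamond-nu (pνgc d refl) (pnu e) =
  let P , a , b = ⇛-diamond d e in eren pred P , ⇛-unshift a , pνgc b (⇛-shifted a)
diamond-nu (pνgc d refl) (pνgc e refl) =
  let P , a , b = ⇛-diamond d e in eren pred P , ⇛-unshift a , ⇛-unshift b

⟶⊆⇛ : ∀ {M N} → M ⟶ N → M ⇛ N
⟶⊆⇛ β         = pβ (⇛-refl _) (⇛-refl _)
⟶⊆⇛ βT        = pβT (⇛-refl _)
⟶⊆⇛ ▷⋆        = p▷⋆ (⇛-refl _)
⟶⊆⇛ verEv     = pverEv
⟶⊆⇛ gen⇒      = pgen⇒
⟶⊆⇛ ver⇒      = pver⇒ (⇛-refl _)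
⟶⊆⇛ gen∀      = pgen∀
⟶⊆⇛ ver∀      = pver∀ (⇛-refl _)
⟶⊆⇛ νgc       = pνgc (⇛-refl _) refl
⟶⊆⇛ (ξlam s)  = plam (⟶⊆⇛ s)
⟶⊆⇛ (ξappₗ s) = papp (⟶⊆⇛ s) (⇛-refl _)
⟶⊆⇛ (ξappᵣ s) = papp (⇛-refl _) (⟶⊆⇛ s)
⟶⊆⇛ (ξLam s)  = pLam (⟶⊆⇛ s)
⟶⊆⇛ (ξtapp s) = ptapp (⟶⊆⇛ s)
⟶⊆⇛ (ξtriₗ s) = ptri (⟶⊆⇛ s) (⇛-refl _)
⟶⊆⇛ (ξtriᵣ s) = ptri (⇛-refl _) (⟶⊆⇛ s)
⟶⊆⇛ (ξver s)  = pver (⟶⊆⇛ s)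
⟶⊆⇛ (ξnu s)   = pnu (⟶⊆⇛ s)

⇛⊆↠ : ∀ {M N} → M ⇛ N → M ↠ N
⇛⊆↠ pvar       = ε
⇛⊆↠ (plam d)   = gmap lam ξlam (⇛⊆↠ d)
⇛⊆↠ (papp d e) = gmap (λ X → app X _) ξappₗ (⇛⊆↠ d) ◅◅ gmap (app _) ξappᵣ (⇛⊆↠ e)
⇛⊆↠ (pLam d)   = gmap Lam ξLam (⇛⊆↠ d)
⇛⊆↠ (ptapp d)  = gmap (λ X → tapp X _) ξtapp (⇛⊆↠ d)
⇛⊆↠ pstar      = ε
⇛⊆↠ (ptri d e) = gmap (λ X → tri X _) ξtriₗ (⇛⊆↠ d) ◅◅ gmap (tri _) ξtriᵣ (⇛⊆↠ e)
⇛⊆↠ pgen       = ε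
⇛⊆↠ (pver d)   = gmap (ver _) ξver (⇛⊆↠ d)
⇛⊆↠ (pnu d)    = gmap nu ξnu (⇛⊆↠ d)
⇛⊆↠ (pβ d e)   =
  gmap (λ X → app (lam X) _) (ξappₗ ∘ ξlam) (⇛⊆↠ d) ◅◅ gmap (app _) ξappᵣ (⇛⊆↠ e) ◅◅ return β
⇛⊆↠ (pβT d)    = gmap (λ X → tapp (Lam X) _) (ξtapp ∘ ξLam) (⇛⊆↠ d) ◅◅ return βT
⇛⊆↠ (p▷⋆ d)    = gmap (tri star) ξtriᵣ (⇛⊆↠ d) ◅◅ return ▷⋆
⇛⊆↠ pverEv     = return verEv
⇛⊆↠ pgen⇒      = return gen⇒
⇛⊆↠ (pver⇒ d)  = gmap (ver _) ξver (⇛⊆↠ d) ◅◅ return ver⇒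
⇛⊆↠ pgen∀      = return gen∀
⇛⊆↠ (pver∀ d)  = gmap (ver _) ξver (⇛⊆↠ d) ◅◅ return ver∀
⇛⊆↠ (pνgc d refl) = gmap nu ξnu (⇛⊆↠ d) ◅◅ return νgc

proposition4p3 : ∀ {M N₁ N₂} → M ↠ N₁ → M ↠ N₂ → ∃ λ P → (N₁ ↠ P) × (N₂ ↠ P)
proposition4p3 = confluent-between ⟶⊆⇛ ⇛⊆↠ (diamond⇒confluent ⇛-diamond)
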